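{- Let $n\ge 0$ and let $Z_n$ be the number of zeros of a random lattice path $W_n$ of length $n$ (as described in the context). Then \[ \mathbb{E}[Z_n] = \frac{4}{n+1}\sum_{0\le k<\ell<\lceil n/2\rceil}\frac{\binom nk}{\binom n\ell} + [n\text{ even}]\,\frac1{n+1}\Bigl(\frac{2^n}{\binom{n}{n/2}}-1\Bigr) + 1. \]
   Context: Random lattice path model: a path $W_n$ of length $n$ starts at $(0,0)$ and uses steps $(1,+1)$ and $(1,-1)$. First an endpoint $(n,D)$ is chosen with $D$ uniformly distributed on $\{ -n,-n+2,\dots,n-2,n\}$; then a path is chosen uniformly at random among all such paths from $(0,0)$ to $(n,D)$. A zero of the path is a point $(x,0)$ on it (including the origin). $[P]=1$ if $P$ is true and $0$ otherwise. -}

module Defs where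

open import Data.Bool using (Bool; true; false; if_then_else_)
open import Data.Nat as ℕ using (ℕ; zero; suc; ⌈_/2⌉; ⌊_/2⌋)
open import Data.Nat.Combinatorics using (_C_)
open import Data.Integer as ℤ using (ℤ; +_; _≟_)
open import Data.Rational using (ℚ; _/_; 0ℚ; 1ℚ; _+_; _*_; _-_)
open import Data.List using (List; []; _∷_; map; filter; length; foldr; upTo; _++_)
open import Data.Vec using (Vec; []; _∷_)

-- a path of length n: a vector of steps, true = (1,+1), false = (1,-1)
step : Bool → ℤ
step true  = + 1
step false = ℤ.- (+ 1)

allPaths : (n : ℕ) → List (Vec Bool n)
allPaths zero    = [] ∷ []
allPaths (suc n) = map (true ∷_) (allPaths n) ++ map (false ∷_) (allPaths n)

heights : ∀ {n} → ℤ → Vec Bool n → List ℤ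
heights h []      = h ∷ []
heights h (s ∷ w) = h ∷ heights (h ℤ.+ step s) w

endH : ∀ {n} → Vec Bool n → ℤ
endH []      = + 0
endH (s ∷ w) = step s ℤ.+ endH w

-- number of zeros (points (x,0) on the path, including the origin)
zeros : ∀ {n} → Vec Bool n → ℕ
zeros w = length (filter (λ h → h ≟ + 0) (heights (+ 0) w))

ℕ→ℚ : ℕ → ℚ
ℕ→ℚ k = + k / 1

-- a / b in ℚ; the b = 0 branch is never used in the statement
-- (all denominators occurring are positive)
divℚ : ℚ → ℕ → ℚ
divℚ a zero    = 0ℚ
divℚ a (suc b) = a * (+ 1 / suc b)

sumℚ : List ℚ → ℚ
sumℚ = foldr _+_ 0ℚ

endpoints : ℕ → List ℤ
endpoints n = map (λ u → + (2 ℕ.* u) ℤ.- + n) (upTo (suc n))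

pathsTo : (n : ℕ) → ℤ → List (Vec Bool n)
pathsTo n D = filter (λ w → endH w ≟ D) (allPaths n)

-- E[Z_n]: D uniform on the n+1 endpoints, then path uniform among pathsTo n D
EZ : ℕ → ℚ
EZ n = sumℚ (map (λ D → divℚ 1ℚ (suc n) *
                         divℚ (sumℚ (map (λ w → ℕ→ℚ (zeros w)) (pathsTo n D)))
                              (length (pathsTo n D)))
                  (endpoints n))

evenInd : ℕ → ℚ
evenInd zero          = 1ℚ
evenInd (suc zero)    = 0ℚ
evenInd (suc (suc n)) = evenInd n

sum2 : ℕ → (ℕ → ℕ → ℚ) → ℚ
sum2 m f = sumℚ (map (λ ℓ → sumℚ (map (λ k → f k ℓ) (upTo ℓ))) (upTo m))

RHS : ℕ → ℚ
RHS n = divℚ (ℕ→ℚ 4) (suc n) * sum2 ⌈ n /2⌉ (λ k ℓ → divℚ (ℕ→ℚ (n C k)) (n C ℓ))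
      + evenInd n * (divℚ 1ℚ (suc n) * (divℚ (ℕ→ℚ (2 ℕ.^ n)) (n C ⌊ n /2⌋) - 1ℚ))
      + 1ℚ

-- Group the paths by their number u of up-steps, i.e. by the endpoint D = 2u - n: then
-- E[Z_n] = 1/(n+1) * Σ_{u ≤ n} G(n,u) / C(n,u), where G(n,u) counts the zeros of all C(n,u)
-- paths with u up-steps. Appending a step creates a new zero exactly when the path returns
-- to 0, so G satisfies Pascal's recurrence up to the extra term C(n+1,u+1) [2u+2 = n+1].
-- Together with the reflection symmetry G(n,u) = G(n,n-u) this gives
-- G(n,u) = C(n,u) + 2 Σ_{k<u} C(n,k) for 2u ≤ n, and G(2m,m) = 2^{2m}; folding the sum over u
-- at its centre by the same symmetry produces the right-hand side.
module Submission where

open import Defs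

module Counting where

  open import Algebra.Bundles using (AbelianGroup)
  open import Data.Bool using (Bool; true; false; not; if_then_else_)
  open import Data.Integer as ℤ using (ℤ)
  import Data.Integer.Properties as ℤₚ
  import Data.Integer.Solver as ℤ-Solver
  open import Data.List using (List; []; _∷_; map; filter; length; _++_; _∷ʳ_)
  open import Data.List.Properties using (map-++; map-∘; length-++; filter-++)
  open import Data.Nat
  open import Data.Nat.Combinatorics using (_C_; nCk≡nC[n∸k]; nCk+nC[k+1]≡[n+1]C[k+1])
  open import Data.Nat.ListAction using (sum)
  open import Data.Nat.ListAction.Properties using (sum-++)
  open import Data.Nat.Properties
  open import Data.Nat.Solver using (module +-*-Solver)
  open import Data.Sum using (inj₁; inj₂)
  open import Data.Vec as Vec using (Vec; []; _∷_; countᵇ)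
  open import Function using (_∘_; id; _⇔_; mk⇔; Equivalence)
  open import Relation.Binary.PropositionalEquality
  open import Relation.Nullary using (Dec; yes; no; does)
  open import Relation.Nullary.Decidable using (does-⇔; dec-true; dec-false)
  open import Relation.Unary using (Decidable)

  open import Algebra.Properties.CommutativeSemigroup +-commutativeSemigroup using (interchange)
  open import Algebra.Properties.Group (AbelianGroup.group ℤₚ.+-0-abelianGroup)
    using (//-rightDividesˡ; //-rightDividesʳ)

  open ≡-Reasoning

  𝟙 : Bool → ℕ
  𝟙 true  = 1
  𝟙 false = 0

  module _ {A : Set} {P : A → Set} (P? : Decidable P) where

    sum-map-filter : ∀ (g : A → ℕ) xs →
                     sum (map g (filter P? xs)) ≡ sum (map (λ x → if does (P? x) then g x else 0) xs)
    sum-map-filter g []       = refl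
    sum-map-filter g (x ∷ xs) with does (P? x)
    ... | true  = cong (g x +_) (sum-map-filter g xs)
    ... | false = sum-map-filter g xs

    length-filter-[_] : ∀ x → length (filter P? (x ∷ [])) ≡ 𝟙 (does (P? x))
    length-filter-[ x ] with does (P? x)
    ... | true  = refl
    ... | false = refl

  length≡sum-map-1 : ∀ {A : Set} (xs : List A) → length xs ≡ sum (map (λ _ → 1) xs)
  length≡sum-map-1 []       = refl
  length≡sum-map-1 (x ∷ xs) = cong suc (length≡sum-map-1 xs)

  length-filter-map : ∀ {A B : Set} {P : A → Set} {Q : B → Set} (P? : Decidable P) (Q? : Decidable Q)
                      (f : B → A) → (∀ x → does (P? (f x)) ≡ does (Q? x)) →
                      ∀ xs → length (filter P? (map f xs)) ≡ length (filter Q? xs)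
  length-filter-map P? Q? f same []       = refl
  length-filter-map P? Q? f same (x ∷ xs) with does (P? (f x)) | does (Q? x) | same x
  ... | true  | .true  | refl = cong suc (length-filter-map P? Q? f same xs)
  ... | false | .false | refl = length-filter-map P? Q? f same xs

  sumPaths : (n : ℕ) → (Vec Bool n → ℕ) → ℕ
  sumPaths zero    F = F []
  sumPaths (suc n) F = sumPaths n (F ∘ (true ∷_)) + sumPaths n (F ∘ (false ∷_))

  sum-map-allPaths : ∀ n (F : Vec Bool n → ℕ) → sum (map F (allPaths n)) ≡ sumPaths n F
  sum-map-allPaths zero    F = +-identityʳ (F [])
  sum-map-allPaths (suc n) F = begin
    sum (map F (map (true ∷_) ps ++ map (false ∷_) ps))
      ≡⟨ cong sum (map-++ F (map (true ∷_) ps) _) ⟩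
    sum (map F (map (true ∷_) ps) ++ map F (map (false ∷_) ps))
      ≡⟨ sum-++ (map F (map (true ∷_) ps)) _ ⟩
    sum (map F (map (true ∷_) ps)) + sum (map F (map (false ∷_) ps))
      ≡⟨ cong₂ _+_ (cong sum (map-∘ ps)) (cong sum (map-∘ ps)) ⟨
    sum (map (F ∘ (true ∷_)) ps) + sum (map (F ∘ (false ∷_)) ps)
      ≡⟨ cong₂ _+_ (sum-map-allPaths n _) (sum-map-allPaths n _) ⟩
    sumPaths (suc n) F ∎
    where ps = allPaths n

  sumPaths-cong : ∀ n {F G : Vec Bool n → ℕ} → (∀ w → F w ≡ G w) → sumPaths n F ≡ sumPaths n G
  sumPaths-cong zero    F≗G = F≗G []
  sumPaths-cong (suc n) F≗G =
    cong₂ _+_ (sumPaths-cong n (F≗G ∘ (true ∷_))) (sumPaths-cong n (F≗G ∘ (false ∷_)))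

  sumPaths-+ : ∀ n (F G : Vec Bool n → ℕ) → sumPaths n (λ w → F w + G w) ≡ sumPaths n F + sumPaths n G
  sumPaths-+ zero    F G = refl
  sumPaths-+ (suc n) F G = trans
    (cong₂ _+_ (sumPaths-+ n (F ∘ (true ∷_)) (G ∘ (true ∷_)))
               (sumPaths-+ n (F ∘ (false ∷_)) (G ∘ (false ∷_))))
    (interchange (sumPaths n (F ∘ (true ∷_))) _ _ _)

  sumPaths-∷ʳ : ∀ n (F : Vec Bool (suc n) → ℕ) →
                sumPaths (suc n) F ≡ sumPaths n (λ w → F (w Vec.∷ʳ true) + F (w Vec.∷ʳ false))
  sumPaths-∷ʳ zero    F = refl
  sumPaths-∷ʳ (suc n) F = cong₂ _+_ (sumPaths-∷ʳ n (F ∘ (true ∷_))) (sumPaths-∷ʳ n (F ∘ (false ∷_)))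

  neg : ∀ {n} → Vec Bool n → Vec Bool n
  neg = Vec.map not

  sumPaths-neg : ∀ n (F : Vec Bool n → ℕ) → sumPaths n F ≡ sumPaths n (F ∘ neg)
  sumPaths-neg zero    F = refl
  sumPaths-neg (suc n) F = trans
    (cong₂ _+_ (sumPaths-neg n (F ∘ (true ∷_))) (sumPaths-neg n (F ∘ (false ∷_))))
    (+-comm (sumPaths n (F ∘ (true ∷_) ∘ neg)) _)

  ups : ∀ {n} → Vec Bool n → ℕ
  ups = countᵇ id

  ups-∷ʳ-true : ∀ {n} (w : Vec Bool n) → ups (w Vec.∷ʳ true) ≡ suc (ups w)
  ups-∷ʳ-true []          = refl
  ups-∷ʳ-true (true ∷ w)  = cong suc (ups-∷ʳ-true w)
  ups-∷ʳ-true (false ∷ w) = ups-∷ʳ-true w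

  ups-∷ʳ-false : ∀ {n} (w : Vec Bool n) → ups (w Vec.∷ʳ false) ≡ ups w
  ups-∷ʳ-false []          = refl
  ups-∷ʳ-false (true ∷ w)  = cong suc (ups-∷ʳ-false w)
  ups-∷ʳ-false (false ∷ w) = ups-∷ʳ-false w

  ups+ups-neg : ∀ {n} (w : Vec Bool n) → ups w + ups (neg w) ≡ n
  ups+ups-neg []          = refl
  ups+ups-neg (true ∷ w)  = cong suc (ups+ups-neg w)
  ups+ups-neg (false ∷ w) = trans (+-suc (ups w) _) (cong suc (ups+ups-neg w))

  endH+n≡ups+ups : ∀ {n} (w : Vec Bool n) → endH w ℤ.+ ℤ.+ n ≡ ℤ.+ (ups w + ups w)
  endH+n≡ups+ups []                  = refl
  endH+n≡ups+ups {suc n} (true ∷ w)  = begin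
    (ℤ.+ 1 ℤ.+ endH w) ℤ.+ (ℤ.+ 1 ℤ.+ ℤ.+ n)
      ≡⟨ solve 3 (λ e N i → (i :+ e) :+ (i :+ N) := i :+ (i :+ (e :+ N))) refl (endH w) (ℤ.+ n) (ℤ.+ 1) ⟩
    ℤ.+ 1 ℤ.+ (ℤ.+ 1 ℤ.+ (endH w ℤ.+ ℤ.+ n))
      ≡⟨ cong (λ e → ℤ.+ 1 ℤ.+ (ℤ.+ 1 ℤ.+ e)) (endH+n≡ups+ups w) ⟩
    ℤ.+ suc (suc (ups w + ups w))
      ≡⟨ cong (ℤ.+_ ∘ suc) (+-suc (ups w) (ups w)) ⟨
    ℤ.+ (suc (ups w) + suc (ups w)) ∎
    where open ℤ-Solver.+-*-Solver
  endH+n≡ups+ups {suc n} (false ∷ w) = begin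
    (ℤ.- ℤ.+ 1 ℤ.+ endH w) ℤ.+ (ℤ.+ 1 ℤ.+ ℤ.+ n)
      ≡⟨ solve 3 (λ e N i → (:- i :+ e) :+ (i :+ N) := e :+ N) refl (endH w) (ℤ.+ n) (ℤ.+ 1) ⟩
    endH w ℤ.+ ℤ.+ n
      ≡⟨ endH+n≡ups+ups w ⟩
    ℤ.+ (ups w + ups w) ∎
    where open ℤ-Solver.+-*-Solver

  endH≡a-n⇔ups+ups≡a : ∀ {n} (w : Vec Bool n) a → (endH w ≡ ℤ.+ a ℤ.- ℤ.+ n) ⇔ (ups w + ups w ≡ a)
  endH≡a-n⇔ups+ups≡a {n} w a = mk⇔
    (λ e≡ → ℤₚ.+-injective (begin
      ℤ.+ (ups w + ups w)                ≡⟨ endH+n≡ups+ups w ⟨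
      endH w ℤ.+ ℤ.+ n                   ≡⟨ cong (ℤ._+ ℤ.+ n) e≡ ⟩
      (ℤ.+ a ℤ.- ℤ.+ n) ℤ.+ ℤ.+ n        ≡⟨ //-rightDividesˡ (ℤ.+ n) (ℤ.+ a) ⟩
      ℤ.+ a                              ∎))
    (λ u≡ → begin
      endH w                             ≡⟨ //-rightDividesʳ (ℤ.+ n) (endH w) ⟨
      (endH w ℤ.+ ℤ.+ n) ℤ.- ℤ.+ n       ≡⟨ cong (ℤ._- ℤ.+ n) (endH+n≡ups+ups w) ⟩
      ℤ.+ (ups w + ups w) ℤ.- ℤ.+ n      ≡⟨ cong (λ k → ℤ.+ k ℤ.- ℤ.+ n) u≡ ⟩
      ℤ.+ a ℤ.- ℤ.+ n                    ∎)

  does-endH≟endpoint : ∀ {n} (w : Vec Bool n) u →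
                       does (endH w ℤ.≟ ℤ.+ (2 * u) ℤ.- ℤ.+ n) ≡ does (ups w ≟ u)
  does-endH≟endpoint {n} w u = does-⇔
    (mk⇔ (λ e≡ → halve (ups w) u (trans (to e≡) (2*n≡n+n u)))
         (λ u≡ → from (trans (cong (λ k → k + k) u≡) (sym (2*n≡n+n u)))))
    (endH w ℤ.≟ ℤ.+ (2 * u) ℤ.- ℤ.+ n) (ups w ≟ u)
    where
    open Equivalence (endH≡a-n⇔ups+ups≡a w (2 * u))
    2*n≡n+n : ∀ n → 2 * n ≡ n + n
    2*n≡n+n n = cong (n +_) (+-identityʳ n)
    halve : ∀ m n → m + m ≡ n + n → m ≡ n
    halve m n eq = *-cancelˡ-≡ m n 2 (trans (2*n≡n+n m) (trans eq (sym (2*n≡n+n n))))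

  does-endH≟0 : ∀ {n} (w : Vec Bool n) → does (endH w ℤ.≟ ℤ.+ 0) ≡ does (ups w + ups w ≟ n)
  does-endH≟0 {n} w = does-⇔
    (mk⇔ (λ e≡ → Equivalence.to (endH≡a-n⇔ups+ups≡a w n) (trans e≡ (sym (ℤₚ.+-inverseʳ (ℤ.+ n)))))
         (λ u≡ → trans (Equivalence.from (endH≡a-n⇔ups+ups≡a w n) u≡) (ℤₚ.+-inverseʳ (ℤ.+ n))))
    (endH w ℤ.≟ ℤ.+ 0) (ups w + ups w ≟ n)

  heights-∷ʳ : ∀ {n} h (w : Vec Bool n) s →
               heights h (w Vec.∷ʳ s) ≡ heights h w ∷ʳ (h ℤ.+ endH (w Vec.∷ʳ s))
  heights-∷ʳ h []      s = cong (λ e → h ∷ (h ℤ.+ e) ∷ []) (sym (ℤₚ.+-identityʳ (step s)))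
  heights-∷ʳ h (x ∷ w) s = cong (h ∷_) (trans (heights-∷ʳ (h ℤ.+ step x) w s)
    (cong (heights (h ℤ.+ step x) w ∷ʳ_) (ℤₚ.+-assoc h (step x) (endH (w Vec.∷ʳ s)))))

  zeros-∷ʳ : ∀ {n} (w : Vec Bool n) s →
             zeros (w Vec.∷ʳ s) ≡ zeros w + 𝟙 (does (ups (w Vec.∷ʳ s) + ups (w Vec.∷ʳ s) ≟ suc n))
  zeros-∷ʳ w s = begin
    zeros (w Vec.∷ʳ s)
      ≡⟨ cong (length ∘ filter isZero?) (heights-∷ʳ (ℤ.+ 0) w s) ⟩
    length (filter isZero? (heights (ℤ.+ 0) w ∷ʳ last))
      ≡⟨ cong length (filter-++ isZero? (heights (ℤ.+ 0) w) (last ∷ [])) ⟩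
    length (filter isZero? (heights (ℤ.+ 0) w) ++ filter isZero? (last ∷ []))
      ≡⟨ length-++ (filter isZero? (heights (ℤ.+ 0) w)) ⟩
    zeros w + length (filter isZero? (last ∷ []))
      ≡⟨ cong (zeros w +_) (length-filter-[_] isZero? last) ⟩
    zeros w + 𝟙 (does (isZero? last))
      ≡⟨ cong (λ h → zeros w + 𝟙 (does (isZero? h))) (ℤₚ.+-identityˡ (endH (w Vec.∷ʳ s))) ⟩
    zeros w + 𝟙 (does (isZero? (endH (w Vec.∷ʳ s))))
      ≡⟨ cong (λ b → zeros w + 𝟙 b) (does-endH≟0 (w Vec.∷ʳ s)) ⟩
    zeros w + 𝟙 (does (ups (w Vec.∷ʳ s) + ups (w Vec.∷ʳ s) ≟ suc _)) ∎
    where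
    isZero? = λ (h : ℤ) → h ℤ.≟ ℤ.+ 0
    last = ℤ.+ 0 ℤ.+ endH (w Vec.∷ʳ s)

  heights-neg : ∀ {n} h (w : Vec Bool n) → heights (ℤ.- h) (neg w) ≡ map ℤ.-_ (heights h w)
  heights-neg h []      = refl
  heights-neg h (s ∷ w) = cong (ℤ.- h ∷_) (trans
    (cong (λ h′ → heights h′ (neg w))
          (trans (cong (ℤ._+_ (ℤ.- h)) (step-not s)) (sym (ℤₚ.neg-distrib-+ h (step s)))))
    (heights-neg (h ℤ.+ step s) w))
    where
    step-not : ∀ s → step (not s) ≡ ℤ.- step s
    step-not true  = refl
    step-not false = refl

  zeros-neg : ∀ {n} (w : Vec Bool n) → zeros (neg w) ≡ zeros w
  zeros-neg w = trans (cong (length ∘ filter isZero?) (heights-neg (ℤ.+ 0) w))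
    (length-filter-map isZero? isZero? (λ i → ℤ.- i)
      (λ h → does-⇔ (mk⇔ ℤₚ.neg-injective (cong (λ i → ℤ.- i))) (isZero? (ℤ.- h)) (isZero? h))
      (heights (ℤ.+ 0) w))
    where isZero? = λ (h : ℤ) → h ℤ.≟ ℤ.+ 0

  restrictUps : ∀ {n} → ℕ → (Vec Bool n → ℕ) → Vec Bool n → ℕ
  restrictUps u F w = if does (ups w ≟ u) then F w else 0

  sumUps : (n u : ℕ) → (Vec Bool n → ℕ) → ℕ
  sumUps n u F = sumPaths n (restrictUps u F)

  sumUps-cong : ∀ n u {F G : Vec Bool n → ℕ} → (∀ w → ups w ≡ u → F w ≡ G w) →
                sumUps n u F ≡ sumUps n u G
  sumUps-cong n u F≗G = sumPaths-cong n (λ w → if-cong (ups w ≟ u) (F≗G w))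
    where
    if-cong : ∀ {P : Set} {x y : ℕ} (P? : Dec P) → (P → x ≡ y) →
              (if does P? then x else 0) ≡ (if does P? then y else 0)
    if-cong (yes p) x≡y = x≡y p
    if-cong (no _)  _   = refl

  sumUps-+ : ∀ n u (F G : Vec Bool n → ℕ) → sumUps n u (λ w → F w + G w) ≡ sumUps n u F + sumUps n u G
  sumUps-+ n u F G = trans (sumPaths-cong n (λ w → if-+ (does (ups w ≟ u)) (F w) (G w))) (sumPaths-+ n _ _)
    where
    if-+ : ∀ b x y → (if b then x + y else 0) ≡ (if b then x else 0) + (if b then y else 0)
    if-+ true  x y = refl
    if-+ false x y = refl

  sumUps-suc-suc : ∀ n v (F : Vec Bool (suc n) → ℕ) →
                   sumUps (suc n) (suc v) F ≡
                   sumUps n v (F ∘ (Vec._∷ʳ true)) + sumUps n (suc v) (F ∘ (Vec._∷ʳ false))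
  sumUps-suc-suc n v F = trans (sumPaths-∷ʳ n (restrictUps (suc v) F)) (trans (sumPaths-cong n (λ w → cong₂ _+_
    (cong (λ k → if does (k ≟ suc v) then F (w Vec.∷ʳ true) else 0) (ups-∷ʳ-true w))
    (cong (λ k → if does (k ≟ suc v) then F (w Vec.∷ʳ false) else 0) (ups-∷ʳ-false w))))
    (sumPaths-+ n _ _))

  sumUps-suc-zero : ∀ n (F : Vec Bool (suc n) → ℕ) →
                    sumUps (suc n) 0 F ≡ sumUps n 0 (F ∘ (Vec._∷ʳ false))
  sumUps-suc-zero n F = trans (sumPaths-∷ʳ n (restrictUps 0 F)) (sumPaths-cong n (λ w → cong₂ _+_
    (cong (λ k → if does (k ≟ 0) then F (w Vec.∷ʳ true) else 0) (ups-∷ʳ-true w))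
    (cong (λ k → if does (k ≟ 0) then F (w Vec.∷ʳ false) else 0) (ups-∷ʳ-false w))))

  sumUps-neg : ∀ n u (F : Vec Bool n → ℕ) → u ≤ n → sumUps n u F ≡ sumUps n (n ∸ u) (F ∘ neg)
  sumUps-neg n u F u≤n = trans (sumPaths-neg n (restrictUps u F)) (sumPaths-cong n (λ w →
    cong (λ b → if b then F (neg w) else 0) (does-⇔ (reflect w) (ups (neg w) ≟ u) (ups w ≟ n ∸ u))))
    where
    reflect : ∀ w → (ups (neg w) ≡ u) ⇔ (ups w ≡ n ∸ u)
    reflect w = mk⇔
      (λ eq → begin
        ups w                      ≡⟨ m+n∸n≡m (ups w) (ups (neg w)) ⟨
        ups w + ups (neg w) ∸ ups (neg w) ≡⟨ cong₂ _∸_ (ups+ups-neg w) eq ⟩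
        n ∸ u                      ∎)
      (λ eq → begin
        ups (neg w)                ≡⟨ m+n∸m≡n (ups w) (ups (neg w)) ⟨
        ups w + ups (neg w) ∸ ups w ≡⟨ cong₂ _∸_ (ups+ups-neg w) eq ⟩
        n ∸ (n ∸ u)                ≡⟨ m∸[m∸n]≡n u≤n ⟩
        u                          ∎)

  sumUps-const : ∀ n u c → sumUps n u (λ _ → c) ≡ (n C u) * c
  sumUps-const zero    zero    c = sym (+-identityʳ c)
  sumUps-const zero    (suc u) c = refl
  sumUps-const (suc n) zero    c = trans (sumUps-suc-zero n _) (sumUps-const n zero c)
  sumUps-const (suc n) (suc v) c = begin
    sumUps (suc n) (suc v) (λ _ → c)     ≡⟨ sumUps-suc-suc n v _ ⟩
    sumUps n v (λ _ → c) + sumUps n (suc v) (λ _ → c)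
                                         ≡⟨ cong₂ _+_ (sumUps-const n v c) (sumUps-const n (suc v) c) ⟩
    (n C v) * c + (n C suc v) * c        ≡⟨ *-distribʳ-+ c (n C v) (n C suc v) ⟨
    (n C v + n C suc v) * c              ≡⟨ cong (_* c) (nCk+nC[k+1]≡[n+1]C[k+1] n v) ⟩
    (suc n C suc v) * c                  ∎

  sum-map-pathsTo : ∀ n u (g : Vec Bool n → ℕ) →
                    sum (map g (pathsTo n (ℤ.+ (2 * u) ℤ.- ℤ.+ n))) ≡ sumUps n u g
  sum-map-pathsTo n u g = begin
    sum (map g (filter (λ w → endH w ℤ.≟ D) (allPaths n)))
      ≡⟨ sum-map-filter (λ w → endH w ℤ.≟ D) g (allPaths n) ⟩
    sum (map (λ w → if does (endH w ℤ.≟ D) then g w else 0) (allPaths n))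
      ≡⟨ sum-map-allPaths n _ ⟩
    sumPaths n (λ w → if does (endH w ℤ.≟ D) then g w else 0)
      ≡⟨ sumPaths-cong n (λ w → cong (λ b → if b then g w else 0) (does-endH≟endpoint w u)) ⟩
    sumUps n u g ∎
    where D = ℤ.+ (2 * u) ℤ.- ℤ.+ n

  length-pathsTo : ∀ n u → length (pathsTo n (ℤ.+ (2 * u) ℤ.- ℤ.+ n)) ≡ n C u
  length-pathsTo n u = begin
    length (pathsTo n D)              ≡⟨ length≡sum-map-1 (pathsTo n D) ⟩
    sum (map (λ _ → 1) (pathsTo n D)) ≡⟨ sum-map-pathsTo n u (λ _ → 1) ⟩
    sumUps n u (λ _ → 1)              ≡⟨ sumUps-const n u 1 ⟩
    (n C u) * 1                       ≡⟨ *-identityʳ (n C u) ⟩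
    n C u                             ∎
    where D = ℤ.+ (2 * u) ℤ.- ℤ.+ n

  binomialPartialSum : ℕ → ℕ → ℕ
  binomialPartialSum n zero    = 0
  binomialPartialSum n (suc u) = binomialPartialSum n u + n C u

  binomialPartialSum-suc-suc : ∀ n v →
    binomialPartialSum (suc n) (suc v) ≡ binomialPartialSum n v + binomialPartialSum n (suc v)
  binomialPartialSum-suc-suc n zero    = refl
  binomialPartialSum-suc-suc n (suc v) = begin
    S′ (suc v) + suc n C suc v
      ≡⟨ cong₂ _+_ (binomialPartialSum-suc-suc n v) (sym (nCk+nC[k+1]≡[n+1]C[k+1] n v)) ⟩
    (S v + (S v + n C v)) + (n C v + n C suc v)
      ≡⟨ solve 3 (λ s c d → (s :+ (s :+ c)) :+ (c :+ d) := (s :+ c) :+ ((s :+ c) :+ d))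
               refl (S v) (n C v) (n C suc v) ⟩
    (S v + n C v) + ((S v + n C v) + n C suc v) ∎
    where
    open +-*-Solver
    S = binomialPartialSum n
    S′ = binomialPartialSum (suc n)

  halfRowSum-even : ∀ m → (m + m) C m + (binomialPartialSum (m + m) m + binomialPartialSum (m + m) m)
                          ≡ 2 ^ (m + m)
  halfRowSum-odd  : ∀ m → binomialPartialSum (suc (m + m)) (suc m) + binomialPartialSum (suc (m + m)) (suc m)
                          ≡ 2 ^ suc (m + m)

  halfRowSum-even zero    = refl
  halfRowSum-even (suc m) =
    subst (λ k → k C suc m + (binomialPartialSum k (suc m) + binomialPartialSum k (suc m)) ≡ 2 ^ k)
    (cong suc (sym (+-suc m m))) (begin
      suc N C suc m + (S′ (suc m) + S′ (suc m))
        ≡⟨ cong₂ (λ a b → a + (b + b))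
                 (sym (nCk+nC[k+1]≡[n+1]C[k+1] N m)) (binomialPartialSum-suc-suc N m) ⟩
      (N C m + N C suc m) + ((S m + S (suc m)) + (S m + S (suc m)))
        ≡⟨ cong (λ d → (N C m + d) + ((S m + S (suc m)) + (S m + S (suc m)))) NCm+1≡NCm ⟩
      (N C m + N C m) + ((S m + S (suc m)) + (S m + S (suc m)))
        ≡⟨ solve 2 (λ c s → (c :+ c) :+ ((s :+ (s :+ c)) :+ (s :+ (s :+ c)))
                         := ((s :+ c) :+ (s :+ c)) :+ (((s :+ c) :+ (s :+ c)) :+ con 0))
             refl (N C m) (S m) ⟩
      ((S m + N C m) + (S m + N C m)) + (((S m + N C m) + (S m + N C m)) + 0)
        ≡⟨ cong (λ z → z + (z + 0)) (halfRowSum-odd m) ⟩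
      2 ^ suc N ∎)
    where
    open +-*-Solver
    N = suc (m + m)
    S = binomialPartialSum N
    S′ = binomialPartialSum (suc N)
    NCm+1≡NCm : N C suc m ≡ N C m
    NCm+1≡NCm = trans (nCk≡nC[n∸k] (s≤s (m≤m+n m m))) (cong (N C_) (m+n∸m≡n m m))

  halfRowSum-odd m = begin
    S′ (suc m) + S′ (suc m)
      ≡⟨ cong (λ b → b + b) (binomialPartialSum-suc-suc (m + m) m) ⟩
    (S m + (S m + (m + m) C m)) + (S m + (S m + (m + m) C m))
      ≡⟨ solve 2 (λ s c → (s :+ (s :+ c)) :+ (s :+ (s :+ c)) := (c :+ (s :+ s)) :+ ((c :+ (s :+ s)) :+ con 0))
               refl (S m) ((m + m) C m) ⟩
    ((m + m) C m + (S m + S m)) + (((m + m) C m + (S m + S m)) + 0)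
      ≡⟨ cong (λ z → z + (z + 0)) (halfRowSum-even m) ⟩
    2 ^ suc (m + m) ∎
    where
    open +-*-Solver
    S = binomialPartialSum (m + m)
    S′ = binomialPartialSum (suc (m + m))

  nCk>0 : ∀ {n k} → k ≤ n → 0 < n C k
  nCk>0 {n}     {zero}  _         = s≤s z≤n
  nCk>0 {suc n} {suc k} (s≤s k≤n) =
    subst (0 <_) (nCk+nC[k+1]≡[n+1]C[k+1] n k) (≤-trans (nCk>0 k≤n) (m≤m+n (n C k) (n C suc k)))

  zeroCount : ℕ → ℕ → ℕ
  zeroCount n u = sumUps n u zeros

  zeros-∷ʳ-ups : ∀ {n} (w : Vec Bool n) s {k} → ups (w Vec.∷ʳ s) ≡ k →
                 zeros (w Vec.∷ʳ s) ≡ zeros w + 𝟙 (does (k + k ≟ suc n))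
  zeros-∷ʳ-ups w s refl = zeros-∷ʳ w s

  zeroCount-suc-zero : ∀ n → zeroCount (suc n) 0 ≡ zeroCount n 0
  zeroCount-suc-zero n = trans (sumUps-suc-zero n zeros) (sumUps-cong n 0 (λ w ups≡0 →
    trans (zeros-∷ʳ-ups w false (trans (ups-∷ʳ-false w) ups≡0)) (+-identityʳ (zeros w))))

  zeroCount-suc-suc : ∀ n v → zeroCount (suc n) (suc v) ≡
                      zeroCount n v + zeroCount n (suc v) + (suc n C suc v) * 𝟙 (does (suc v + suc v ≟ suc n))
  zeroCount-suc-suc n v = begin
    zeroCount (suc n) (suc v)
      ≡⟨ sumUps-suc-suc n v zeros ⟩
    sumUps n v (zeros ∘ (Vec._∷ʳ true)) + sumUps n (suc v) (zeros ∘ (Vec._∷ʳ false))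
      ≡⟨ cong₂ _+_
           (sumUps-cong n v (λ w ups≡v → zeros-∷ʳ-ups w true (trans (ups-∷ʳ-true w) (cong suc ups≡v))))
           (sumUps-cong n (suc v) (λ w ups≡ → zeros-∷ʳ-ups w false (trans (ups-∷ʳ-false w) ups≡))) ⟩
    sumUps n v (λ w → zeros w + c) + sumUps n (suc v) (λ w → zeros w + c)
      ≡⟨ cong₂ _+_ (sumUps-+ n v zeros _) (sumUps-+ n (suc v) zeros _) ⟩
    (zeroCount n v + sumUps n v (λ _ → c)) + (zeroCount n (suc v) + sumUps n (suc v) (λ _ → c))
      ≡⟨ interchange (zeroCount n v) _ _ _ ⟩
    zeroCount n v + zeroCount n (suc v) + (sumUps n v (λ _ → c) + sumUps n (suc v) (λ _ → c))
      ≡⟨ cong (zeroCount n v + zeroCount n (suc v) +_)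
           (trans (sym (sumUps-suc-suc n v (λ _ → c))) (sumUps-const (suc n) (suc v) c)) ⟩
    zeroCount n v + zeroCount n (suc v) + (suc n C suc v) * c ∎
    where c = 𝟙 (does (suc v + suc v ≟ suc n))

  zeroCount-sym : ∀ n u → u ≤ n → zeroCount n u ≡ zeroCount n (n ∸ u)
  zeroCount-sym n u u≤n = trans (sumUps-neg n u zeros u≤n) (sumUps-cong n (n ∸ u) (λ w _ → zeros-neg w))

  zeroCount≡ : ∀ n u → u + u ≤ n → zeroCount n u ≡ n C u + (binomialPartialSum n u + binomialPartialSum n u)
  zeroCount≡ zero    zero    _ = refl
  zeroCount≡ (suc n) zero    _ = trans (zeroCount-suc-zero n) (zeroCount≡ n zero z≤n)
  zeroCount≡ (suc n) (suc v) 2v+2≤n+1 with m≤n⇒m<n∨m≡n 2v+2≤n+1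
  ... | inj₁ (s≤s 2v+2≤n) = begin
    zeroCount (suc n) (suc v)
      ≡⟨ zeroCount-suc-suc n v ⟩
    zeroCount n v + zeroCount n (suc v) + (suc n C suc v) * 𝟙 (does (suc v + suc v ≟ suc n))
      ≡⟨ cong₂ (λ a b → a + (suc n C suc v) * 𝟙 b)
           (cong₂ _+_ (zeroCount≡ n v 2v≤n) (zeroCount≡ n (suc v) 2v+2≤n))
           (dec-false (suc v + suc v ≟ suc n) (<⇒≢ (s≤s 2v+2≤n))) ⟩
    (n C v + (S v + S v)) + (n C suc v + (S (suc v) + S (suc v))) + (suc n C suc v) * 0
      ≡⟨ solve 5 (λ c d s t e → (c :+ (s :+ s)) :+ (d :+ (t :+ t)) :+ e :* con 0
                             := (c :+ d) :+ ((s :+ t) :+ (s :+ t)))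
           refl (n C v) (n C suc v) (S v) (S (suc v)) (suc n C suc v) ⟩
    (n C v + n C suc v) + ((S v + S (suc v)) + (S v + S (suc v)))
      ≡⟨ cong₂ (λ a b → a + (b + b)) (nCk+nC[k+1]≡[n+1]C[k+1] n v) (sym (binomialPartialSum-suc-suc n v)) ⟩
    suc n C suc v + (S′ (suc v) + S′ (suc v)) ∎
    where
    open +-*-Solver
    S = binomialPartialSum n
    S′ = binomialPartialSum (suc n)
    2v≤n : v + v ≤ n
    2v≤n = ≤-trans (+-mono-≤ (n≤1+n v) (n≤1+n v)) 2v+2≤n
  ... | inj₂ 2v+2≡n+1 = begin
    zeroCount (suc n) (suc v)
      ≡⟨ zeroCount-suc-suc n v ⟩
    zeroCount n v + zeroCount n (suc v) + (suc n C suc v) * 𝟙 (does (suc v + suc v ≟ suc n))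
      ≡⟨ cong₂ (λ a b → zeroCount n v + a + (suc n C suc v) * 𝟙 b)
           (trans (zeroCount-sym n (suc v) v+1≤n) (cong (zeroCount n) n∸[v+1]≡v))
           (dec-true (suc v + suc v ≟ suc n) 2v+2≡n+1) ⟩
    zeroCount n v + zeroCount n v + (suc n C suc v) * 1
      ≡⟨ cong (λ z → z + z + (suc n C suc v) * 1) (zeroCount≡ n v 2v≤n) ⟩
    (n C v + (S v + S v)) + (n C v + (S v + S v)) + (suc n C suc v) * 1
      ≡⟨ solve 3 (λ c s e → (c :+ (s :+ s)) :+ (c :+ (s :+ s)) :+ e :* con 1
                           := e :+ ((s :+ (s :+ c)) :+ (s :+ (s :+ c))))
           refl (n C v) (S v) (suc n C suc v) ⟩
    suc n C suc v + ((S v + S (suc v)) + (S v + S (suc v)))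
      ≡⟨ cong (λ b → suc n C suc v + (b + b)) (binomialPartialSum-suc-suc n v) ⟨
    suc n C suc v + (S′ (suc v) + S′ (suc v)) ∎
    where
    open +-*-Solver
    S = binomialPartialSum n
    S′ = binomialPartialSum (suc n)
    n≡v+[v+1] : n ≡ v + suc v
    n≡v+[v+1] = sym (suc-injective 2v+2≡n+1)
    v+1≤n : suc v ≤ n
    v+1≤n = subst (suc v ≤_) (sym n≡v+[v+1]) (m≤n+m (suc v) v)
    n∸[v+1]≡v : n ∸ suc v ≡ v
    n∸[v+1]≡v = trans (cong (_∸ suc v) n≡v+[v+1]) (m+n∸n≡m v (suc v))
    2v≤n : v + v ≤ n
    2v≤n = subst (v + v ≤_) (sym n≡v+[v+1]) (+-monoʳ-≤ v (n≤1+n v))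

open Counting

open import Algebra.Bundles using (CommutativeMonoid)
open import Data.Integer as ℤ using (ℤ)
import Data.Integer.Properties as ℤₚ
open import Data.List using ([]; _∷_; map; length; applyUpTo; upTo)
open import Data.List.Properties using (map-∘)
open import Data.Nat as ℕ using (ℕ; zero; suc; _≤_; _<_; z≤n; s≤s; _∸_; _^_; ⌈_/2⌉; ⌊_/2⌋)
open import Data.Nat.Combinatorics using (_C_; nCk≡nC[n∸k])
open import Data.Nat.Coprimality as Coprime using (1-coprimeTo)
open import Data.Nat.ListAction using (sum)
import Data.Nat.Properties as ℕₚ
open import Data.Rational using (ℚ; mkℚ; 0ℚ; 1ℚ; _+_; _*_; _-_; _/_; toℚᵘ; fromℚᵘ)
import Data.Rational.Properties as ℚₚ
open import Data.Rational.Solver using (module +-*-Solver)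
open import Data.Rational.Unnormalised as ℚᵘ using (mkℚᵘ; *≡*)
import Data.Rational.Unnormalised.Properties as ℚᵘₚ
open import Function using (_∘_; id)
open import Relation.Binary.PropositionalEquality

open import Algebra.Properties.CommutativeSemigroup
  (CommutativeMonoid.commutativeSemigroup ℚₚ.+-0-commutativeMonoid) using (interchange)

open ≡-Reasoning

ℕ→ℚ-+ : ∀ a b → ℕ→ℚ (a ℕ.+ b) ≡ ℕ→ℚ a + ℕ→ℚ b
ℕ→ℚ-+ a b = begin
  ℕ→ℚ (a ℕ.+ b)                             ≡⟨ ℚₚ.fromℚᵘ-cong integral-+ ⟩
  fromℚᵘ (toℚᵘ (ℕ→ℚ a) ℚᵘ.+ toℚᵘ (ℕ→ℚ b)) ≡⟨ ℚₚ.fromℚᵘ-cong (ℚᵘₚ.≃-sym (ℚₚ.toℚᵘ-homo-+ (ℕ→ℚ a) (ℕ→ℚ b))) ⟩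
  fromℚᵘ (toℚᵘ (ℕ→ℚ a + ℕ→ℚ b))           ≡⟨ ℚₚ.fromℚᵘ-toℚᵘ (ℕ→ℚ a + ℕ→ℚ b) ⟩
  ℕ→ℚ a + ℕ→ℚ b                             ∎
  where
  integral-+ : mkℚᵘ (ℤ.+ (a ℕ.+ b)) 0 ℚᵘ.≃ toℚᵘ (ℕ→ℚ a) ℚᵘ.+ toℚᵘ (ℕ→ℚ b)
  integral-+ = ℚᵘₚ.≃-trans
    (*≡* (trans (ℤₚ.*-identityʳ _) (sym (trans (ℤₚ.*-identityʳ _)
      (cong₂ ℤ._+_ (ℤₚ.*-identityʳ (ℤ.+ a)) (ℤₚ.*-identityʳ (ℤ.+ b)))))))
    (ℚᵘₚ.+-cong (ℚᵘₚ.≃-sym (ℚₚ.toℚᵘ-fromℚᵘ (mkℚᵘ (ℤ.+ a) 0)))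
                (ℚᵘₚ.≃-sym (ℚₚ.toℚᵘ-fromℚᵘ (mkℚᵘ (ℤ.+ b) 0))))

recip : ℕ → ℚ
recip zero    = 0ℚ
recip (suc b) = ℤ.+ 1 / suc b

divℚ≡*recip : ∀ a c → divℚ a c ≡ a * recip c
divℚ≡*recip a zero    = sym (ℚₚ.*-zeroʳ a)
divℚ≡*recip a (suc c) = refl

ℕ→ℚ-*-recip : ∀ c → 0 < c → ℕ→ℚ c * recip c ≡ 1ℚ
ℕ→ℚ-*-recip (suc b) _ = trans
  (cong₂ _*_ (ℚₚ.normalize-coprime (Coprime.sym (1-coprimeTo (suc b))))
             (ℚₚ.normalize-coprime (1-coprimeTo (suc b))))
  (ℚₚ.*-inverseʳ (mkℚ (ℤ.+ suc b) 0 (Coprime.sym (1-coprimeTo (suc b)))))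

∑< : ℕ → (ℕ → ℚ) → ℚ
∑< zero    f = 0ℚ
∑< (suc m) f = f 0 + ∑< m (f ∘ suc)

sumℚ-map-applyUpTo : ∀ (f : ℕ → ℚ) g m → sumℚ (map f (applyUpTo g m)) ≡ ∑< m (f ∘ g)
sumℚ-map-applyUpTo f g zero    = refl
sumℚ-map-applyUpTo f g (suc m) = cong (f (g 0) +_) (sumℚ-map-applyUpTo f (g ∘ suc) m)

sumℚ-map-upTo : ∀ (f : ℕ → ℚ) m → sumℚ (map f (upTo m)) ≡ ∑< m f
sumℚ-map-upTo f = sumℚ-map-applyUpTo f id

sumℚ-map-ℕ→ℚ : ∀ {A : Set} (g : A → ℕ) xs → sumℚ (map (ℕ→ℚ ∘ g) xs) ≡ ℕ→ℚ (sum (map g xs))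
sumℚ-map-ℕ→ℚ g []       = refl
sumℚ-map-ℕ→ℚ g (x ∷ xs) =
  trans (cong (ℕ→ℚ (g x) +_) (sumℚ-map-ℕ→ℚ g xs)) (sym (ℕ→ℚ-+ (g x) (sum (map g xs))))

∑<-cong : ∀ m {f g : ℕ → ℚ} → (∀ u → u < m → f u ≡ g u) → ∑< m f ≡ ∑< m g
∑<-cong zero    f≗g = refl
∑<-cong (suc m) f≗g = cong₂ _+_ (f≗g 0 (s≤s z≤n)) (∑<-cong m (λ u u<m → f≗g (suc u) (s≤s u<m)))

∑<-+ : ∀ m (f g : ℕ → ℚ) → ∑< m (λ u → f u + g u) ≡ ∑< m f + ∑< m g
∑<-+ zero    f g = refl
∑<-+ (suc m) f g = trans (cong (f 0 + g 0 +_) (∑<-+ m (f ∘ suc) (g ∘ suc))) (interchange (f 0) (g 0) _ _)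

∑<-*ˡ : ∀ m c (f : ℕ → ℚ) → ∑< m (λ u → c * f u) ≡ c * ∑< m f
∑<-*ˡ zero    c f = sym (ℚₚ.*-zeroʳ c)
∑<-*ˡ (suc m) c f = trans (cong (c * f 0 +_) (∑<-*ˡ m c (f ∘ suc))) (sym (ℚₚ.*-distribˡ-+ c (f 0) _))

∑<-*ʳ : ∀ m c (f : ℕ → ℚ) → ∑< m (λ u → f u * c) ≡ ∑< m f * c
∑<-*ʳ m c f =
  trans (∑<-cong m (λ u _ → ℚₚ.*-comm (f u) c)) (trans (∑<-*ˡ m c f) (ℚₚ.*-comm c (∑< m f)))

∑<-suc : ∀ m (f : ℕ → ℚ) → ∑< (suc m) f ≡ ∑< m f + f m
∑<-suc zero    f = trans (ℚₚ.+-identityʳ (f 0)) (sym (ℚₚ.+-identityˡ (f 0)))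
∑<-suc (suc m) f = trans (cong (f 0 +_) (∑<-suc m (f ∘ suc))) (sym (ℚₚ.+-assoc (f 0) _ _))

∑<-+-split : ∀ a b (f : ℕ → ℚ) → ∑< (a ℕ.+ b) f ≡ ∑< a f + ∑< b (λ u → f (a ℕ.+ u))
∑<-+-split zero    b f = sym (ℚₚ.+-identityˡ _)
∑<-+-split (suc a) b f = trans (cong (f 0 +_) (∑<-+-split a b (f ∘ suc))) (sym (ℚₚ.+-assoc (f 0) _ _))

∑<-reverse : ∀ m (f : ℕ → ℚ) → ∑< m f ≡ ∑< m (λ u → f (m ∸ suc u))
∑<-reverse zero    f = refl
∑<-reverse (suc m) f = begin
  f 0 + ∑< m (f ∘ suc)
    ≡⟨ cong (f 0 +_) (∑<-reverse m (f ∘ suc)) ⟩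
  f 0 + ∑< m (λ u → f (suc (m ∸ suc u)))
    ≡⟨ cong (f 0 +_) (∑<-cong m (λ u u<m → cong f (sym (ℕₚ.+-∸-assoc 1 u<m)))) ⟩
  f 0 + ∑< m (λ u → f (m ∸ u))
    ≡⟨ ℚₚ.+-comm (f 0) _ ⟩
  ∑< m (λ u → f (m ∸ u)) + f 0
    ≡⟨ cong (λ k → ∑< m (λ u → f (m ∸ u)) + f k) (ℕₚ.n∸n≡0 m) ⟨
  ∑< m (λ u → f (m ∸ u)) + f (m ∸ m)
    ≡⟨ ∑<-suc m (λ u → f (m ∸ u)) ⟨
  ∑< (suc m) (λ u → f (m ∸ u)) ∎

∑<-1 : ∀ m → ∑< m (λ _ → 1ℚ) ≡ ℕ→ℚ m
∑<-1 zero    = refl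
∑<-1 (suc m) = trans (cong (1ℚ +_) (∑<-1 m)) (sym (ℕ→ℚ-+ 1 m))

∑<-palindrome : ∀ n a b (f : ℕ → ℚ) → a ℕ.+ b ≡ suc n →
                (∀ u → u ≤ n → f u ≡ f (n ∸ u)) → ∑< (suc n) f ≡ ∑< a f + ∑< b f
∑<-palindrome n a b f a+b≡n+1 f-sym = begin
  ∑< (suc n) f                                  ≡⟨ cong (λ k → ∑< k f) a+b≡n+1 ⟨
  ∑< (a ℕ.+ b) f                                ≡⟨ ∑<-+-split a b f ⟩
  ∑< a f + ∑< b (λ u → f (a ℕ.+ u))             ≡⟨ cong (∑< a f +_) (∑<-reverse b (f ∘ (a ℕ.+_))) ⟩
  ∑< a f + ∑< b (λ u → f (a ℕ.+ (b ∸ suc u)))   ≡⟨ cong (∑< a f +_) (∑<-cong b mirror) ⟩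
  ∑< a f + ∑< b f                               ∎
  where
  split : ∀ u → u < b → n ≡ a ℕ.+ (b ∸ suc u) ℕ.+ u
  split u u<b = ℕₚ.suc-injective (begin
    suc n                               ≡⟨ a+b≡n+1 ⟨
    a ℕ.+ b                             ≡⟨ cong (a ℕ.+_) (ℕₚ.m∸n+n≡m u<b) ⟨
    a ℕ.+ ((b ∸ suc u) ℕ.+ suc u)       ≡⟨ cong (a ℕ.+_) (ℕₚ.+-suc (b ∸ suc u) u) ⟩
    a ℕ.+ suc ((b ∸ suc u) ℕ.+ u)       ≡⟨ ℕₚ.+-suc a _ ⟩
    suc (a ℕ.+ ((b ∸ suc u) ℕ.+ u))     ≡⟨ cong suc (ℕₚ.+-assoc a (b ∸ suc u) u) ⟨
    suc (a ℕ.+ (b ∸ suc u) ℕ.+ u)       ∎)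
  mirror : ∀ u → u < b → f (a ℕ.+ (b ∸ suc u)) ≡ f u
  mirror u u<b = begin
    f k                    ≡⟨ f-sym k (subst (k ≤_) (sym (split u u<b)) (ℕₚ.m≤m+n k u)) ⟩
    f (n ∸ k)              ≡⟨ cong (λ n′ → f (n′ ∸ k)) (split u u<b) ⟩
    f (k ℕ.+ u ∸ k)        ≡⟨ cong f (ℕₚ.m+n∸m≡n k u) ⟩
    f u                    ∎
    where k = a ℕ.+ (b ∸ suc u)

meanZeros : ℕ → ℕ → ℚ
meanZeros n u = ℕ→ℚ (zeroCount n u) * recip (n C u)

binomialRatioSum : ℕ → ℕ → ℚ
binomialRatioSum n ℓ = ℕ→ℚ (binomialPartialSum n ℓ) * recip (n C ℓ)

meanZeros≡ : ∀ n u → u ℕ.+ u ≤ n → meanZeros n u ≡ 1ℚ + (binomialRatioSum n u + binomialRatioSum n u)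
meanZeros≡ n u 2u≤n = begin
  ℕ→ℚ (zeroCount n u) * r
    ≡⟨ cong (λ k → ℕ→ℚ k * r) (zeroCount≡ n u 2u≤n) ⟩
  ℕ→ℚ (n C u ℕ.+ (binomialPartialSum n u ℕ.+ binomialPartialSum n u)) * r
    ≡⟨ cong (_* r) (trans (ℕ→ℚ-+ (n C u) _) (cong (c +_) (ℕ→ℚ-+ (binomialPartialSum n u) _))) ⟩
  (c + (s + s)) * r
    ≡⟨ solve 3 (λ c s r → (c :+ (s :+ s)) :* r := c :* r :+ (s :* r :+ s :* r)) refl c s r ⟩
  c * r + (s * r + s * r)
    ≡⟨ cong (_+ (s * r + s * r)) (ℕ→ℚ-*-recip (n C u) (nCk>0 (ℕₚ.m+n≤o⇒m≤o u 2u≤n))) ⟩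
  1ℚ + (s * r + s * r) ∎
  where
  open +-*-Solver
  c = ℕ→ℚ (n C u)
  s = ℕ→ℚ (binomialPartialSum n u)
  r = recip (n C u)

meanZeros-sym : ∀ n u → u ≤ n → meanZeros n u ≡ meanZeros n (n ∸ u)
meanZeros-sym n u u≤n = cong₂ (λ z c → ℕ→ℚ z * recip c) (zeroCount-sym n u u≤n) (nCk≡nC[n∸k] u≤n)

meanZeros-central : ∀ m → meanZeros (m ℕ.+ m) m ≡ ℕ→ℚ (2 ^ (m ℕ.+ m)) * recip ((m ℕ.+ m) C m)
meanZeros-central m = cong (λ z → ℕ→ℚ z * recip ((m ℕ.+ m) C m))
  (trans (zeroCount≡ (m ℕ.+ m) m ℕₚ.≤-refl) (halfRowSum-even m))

∑<-meanZeros-lowerHalf : ∀ n a → a ℕ.+ a ≤ suc n →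
  ∑< a (meanZeros n) ≡ ℕ→ℚ a + (∑< a (binomialRatioSum n) + ∑< a (binomialRatioSum n))
∑<-meanZeros-lowerHalf n a 2a≤n+1 = begin
  ∑< a (meanZeros n)
    ≡⟨ ∑<-cong a (λ u u<a → meanZeros≡ n u (2u≤n u u<a)) ⟩
  ∑< a (λ u → 1ℚ + (binomialRatioSum n u + binomialRatioSum n u))
    ≡⟨ ∑<-+ a _ _ ⟩
  ∑< a (λ _ → 1ℚ) + ∑< a (λ u → binomialRatioSum n u + binomialRatioSum n u)
    ≡⟨ cong₂ _+_ (∑<-1 a) (∑<-+ a _ _) ⟩
  ℕ→ℚ a + (∑< a (binomialRatioSum n) + ∑< a (binomialRatioSum n)) ∎
  where
  2u≤n : ∀ u → u < a → u ℕ.+ u ≤ n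
  2u≤n u u<a = ℕₚ.≤-trans (ℕₚ.+-monoʳ-≤ u (ℕₚ.n≤1+n u))
    (ℕₚ.≤-pred (ℕₚ.≤-trans (ℕₚ.+-mono-≤ u<a u<a) 2a≤n+1))

-- RHS n = excess n / (n + 1) + 1
excess : ℕ → ℚ
excess n = ℕ→ℚ 4 * ∑< ⌈ n /2⌉ (binomialRatioSum n) + evenInd n * (ℕ→ℚ (2 ^ n) * recip (n C ⌊ n /2⌋) - 1ℚ)

data Halving : ℕ → Set where
  even : ∀ m → Halving (m ℕ.+ m)
  odd  : ∀ m → Halving (suc (m ℕ.+ m))

halving : ∀ n → Halving n
halving zero    = even 0
halving (suc n) with halving n
... | even m = odd m
... | odd  m = subst Halving (cong suc (ℕₚ.+-suc m m)) (even (suc m))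

evenInd-even : ∀ m → evenInd (m ℕ.+ m) ≡ 1ℚ
evenInd-even zero    = refl
evenInd-even (suc m) = trans (cong (evenInd ∘ suc) (ℕₚ.+-suc m m)) (evenInd-even m)

evenInd-odd : ∀ m → evenInd (suc (m ℕ.+ m)) ≡ 0ℚ
evenInd-odd zero    = refl
evenInd-odd (suc m) = trans (cong (evenInd ∘ suc ∘ suc) (ℕₚ.+-suc m m)) (evenInd-odd m)

∑<-meanZeros : ∀ n → ∑< (suc n) (meanZeros n) ≡ ℕ→ℚ (suc n) + excess n
∑<-meanZeros n with halving n
... | even m = begin
  ∑< (suc n) q
    ≡⟨ ∑<-palindrome n (suc m) m q refl (meanZeros-sym n) ⟩
  ∑< (suc m) q + ∑< m q
    ≡⟨ cong (_+ ∑< m q) (∑<-suc m q) ⟩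
  ∑< m q + q m + ∑< m q
    ≡⟨ cong₂ (λ x y → x + y + x) (∑<-meanZeros-lowerHalf n m (ℕₚ.n≤1+n n)) (meanZeros-central m) ⟩
  (ℕ→ℚ m + (R + R)) + T + (ℕ→ℚ m + (R + R))
    ≡⟨ solve 3 (λ M R T → (M :+ (R :+ R)) :+ T :+ (M :+ (R :+ R))
                        := (con 1ℚ :+ (M :+ M)) :+ (con (ℕ→ℚ 4) :* R :+ con 1ℚ :* (T :- con 1ℚ)))
         refl (ℕ→ℚ m) R T ⟩
  (1ℚ + (ℕ→ℚ m + ℕ→ℚ m)) + (ℕ→ℚ 4 * R + 1ℚ * (T - 1ℚ))
    ≡⟨ cong₂ _+_ (trans (cong (1ℚ +_) (sym (ℕ→ℚ-+ m m))) (sym (ℕ→ℚ-+ 1 n)))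
                 (cong₃ (λ c e h → ℕ→ℚ 4 * ∑< c (binomialRatioSum n) + e * (ℕ→ℚ (2 ^ n) * recip (n C h) - 1ℚ))
                        (ℕₚ.n≡⌈n+n/2⌉ m) (sym (evenInd-even m)) (ℕₚ.n≡⌊n+n/2⌋ m)) ⟩
  ℕ→ℚ (suc n) + excess n ∎
  where
  open +-*-Solver
  q = meanZeros n
  R = ∑< m (binomialRatioSum n)
  T = ℕ→ℚ (2 ^ n) * recip (n C m)
  cong₃ : ∀ {A B C D : Set} (f : A → B → C → D) {x y u v s t} →
          x ≡ y → u ≡ v → s ≡ t → f x u s ≡ f y v t
  cong₃ f refl refl refl = refl
... | odd m = begin
  ∑< (suc n) q
    ≡⟨ ∑<-palindrome n (suc m) (suc m) q (cong suc (ℕₚ.+-suc m m)) (meanZeros-sym n) ⟩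
  ∑< (suc m) q + ∑< (suc m) q
    ≡⟨ cong (λ x → x + x) (∑<-meanZeros-lowerHalf n (suc m) (ℕₚ.≤-reflexive (cong suc (ℕₚ.+-suc m m)))) ⟩
  (M + (R + R)) + (M + (R + R))
    ≡⟨ solve 3 (λ M R Z → (M :+ (R :+ R)) :+ (M :+ (R :+ R))
                        := (M :+ M) :+ (con (ℕ→ℚ 4) :* R :+ con 0ℚ :* Z))
         refl M R Z ⟩
  (M + M) + (ℕ→ℚ 4 * R + 0ℚ * Z)
    ≡⟨ cong₂ _+_ (trans (sym (ℕ→ℚ-+ (suc m) (suc m))) (cong (ℕ→ℚ ∘ suc) (ℕₚ.+-suc m m)))
                 (cong₂ (λ c e → ℕ→ℚ 4 * ∑< c (binomialRatioSum n) + e * Z)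
                        (cong suc (ℕₚ.n≡⌊n+n/2⌋ m)) (sym (evenInd-odd m))) ⟩
  ℕ→ℚ (suc n) + excess n ∎
  where
  open +-*-Solver
  q = meanZeros n
  M = ℕ→ℚ (suc m)
  R = ∑< (suc m) (binomialRatioSum n)
  Z = ℕ→ℚ (2 ^ n) * recip (n C ⌊ n /2⌋) - 1ℚ

EZ≡ : ∀ n → EZ n ≡ recip (suc n) * ∑< (suc n) (meanZeros n)
EZ≡ n = begin
  sumℚ (map H (map e (upTo (suc n))))                ≡⟨ cong sumℚ (map-∘ {g = H} {f = e} (upTo (suc n))) ⟨
  sumℚ (map (H ∘ e) (upTo (suc n)))                  ≡⟨ sumℚ-map-upTo (H ∘ e) (suc n) ⟩
  ∑< (suc n) (H ∘ e)                                 ≡⟨ ∑<-cong (suc n) (λ u _ → H-endpoint u) ⟩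
  ∑< (suc n) (λ u → recip (suc n) * meanZeros n u)   ≡⟨ ∑<-*ˡ (suc n) (recip (suc n)) (meanZeros n) ⟩
  recip (suc n) * ∑< (suc n) (meanZeros n)           ∎
  where
  e : ℕ → ℤ
  e u = ℤ.+ (2 ℕ.* u) ℤ.- ℤ.+ n
  H : ℤ → ℚ
  H D = divℚ 1ℚ (suc n) * divℚ (sumℚ (map (λ w → ℕ→ℚ (zeros w)) (pathsTo n D))) (length (pathsTo n D))
  H-endpoint : ∀ u → H (e u) ≡ recip (suc n) * meanZeros n u
  H-endpoint u = cong₂ _*_ (ℚₚ.*-identityˡ (recip (suc n))) (begin
    divℚ (sumℚ (map (ℕ→ℚ ∘ zeros) (pathsTo n (e u)))) (length (pathsTo n (e u)))
      ≡⟨ divℚ≡*recip _ (length (pathsTo n (e u))) ⟩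
    sumℚ (map (ℕ→ℚ ∘ zeros) (pathsTo n (e u))) * recip (length (pathsTo n (e u)))
      ≡⟨ cong₂ (λ x k → x * recip k)
           (trans (sumℚ-map-ℕ→ℚ zeros (pathsTo n (e u))) (cong ℕ→ℚ (sum-map-pathsTo n u zeros)))
           (length-pathsTo n u) ⟩
    meanZeros n u ∎)

∑<-binomial : ∀ n ℓ → ∑< ℓ (λ k → ℕ→ℚ (n C k)) ≡ ℕ→ℚ (binomialPartialSum n ℓ)
∑<-binomial n zero    = refl
∑<-binomial n (suc ℓ) = begin
  ∑< (suc ℓ) (λ k → ℕ→ℚ (n C k))
    ≡⟨ ∑<-suc ℓ (λ k → ℕ→ℚ (n C k)) ⟩
  ∑< ℓ (λ k → ℕ→ℚ (n C k)) + ℕ→ℚ (n C ℓ)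
    ≡⟨ cong (_+ ℕ→ℚ (n C ℓ)) (∑<-binomial n ℓ) ⟩
  ℕ→ℚ (binomialPartialSum n ℓ) + ℕ→ℚ (n C ℓ)
    ≡⟨ ℕ→ℚ-+ (binomialPartialSum n ℓ) (n C ℓ) ⟨
  ℕ→ℚ (binomialPartialSum n (suc ℓ)) ∎

sum2-binomialRatios : ∀ n m → sum2 m (λ k ℓ → divℚ (ℕ→ℚ (n C k)) (n C ℓ)) ≡ ∑< m (binomialRatioSum n)
sum2-binomialRatios n m = trans (sumℚ-map-upTo _ m) (∑<-cong m (λ ℓ _ → begin
  sumℚ (map (λ k → divℚ (ℕ→ℚ (n C k)) (n C ℓ)) (upTo ℓ))
    ≡⟨ sumℚ-map-upTo _ ℓ ⟩
  ∑< ℓ (λ k → divℚ (ℕ→ℚ (n C k)) (n C ℓ))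
    ≡⟨ ∑<-cong ℓ (λ k _ → divℚ≡*recip (ℕ→ℚ (n C k)) (n C ℓ)) ⟩
  ∑< ℓ (λ k → ℕ→ℚ (n C k) * recip (n C ℓ))
    ≡⟨ ∑<-*ʳ ℓ (recip (n C ℓ)) (λ k → ℕ→ℚ (n C k)) ⟩
  ∑< ℓ (λ k → ℕ→ℚ (n C k)) * recip (n C ℓ)
    ≡⟨ cong (_* recip (n C ℓ)) (∑<-binomial n ℓ) ⟩
  binomialRatioSum n ℓ ∎))

RHS≡ : ∀ n → RHS n ≡ recip (suc n) * excess n + 1ℚ
RHS≡ n = begin
  RHS n
    ≡⟨ cong₂ (λ s d → (ℕ→ℚ 4 * ι) * s + evenInd n * ((1ℚ * ι) * (d - 1ℚ)) + 1ℚ)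
             (sum2-binomialRatios n ⌈ n /2⌉) (divℚ≡*recip (ℕ→ℚ (2 ^ n)) (n C ⌊ n /2⌋)) ⟩
  (ℕ→ℚ 4 * ι) * R + evenInd n * ((1ℚ * ι) * (T - 1ℚ)) + 1ℚ
    ≡⟨ solve 4 (λ ι R e T → (con (ℕ→ℚ 4) :* ι) :* R :+ e :* ((con 1ℚ :* ι) :* (T :- con 1ℚ)) :+ con 1ℚ
                          := ι :* (con (ℕ→ℚ 4) :* R :+ e :* (T :- con 1ℚ)) :+ con 1ℚ)
         refl ι R (evenInd n) T ⟩
  ι * excess n + 1ℚ ∎
  where
  open +-*-Solver
  ι = recip (suc n)
  R = ∑< ⌈ n /2⌉ (binomialRatioSum n)
  T = ℕ→ℚ (2 ^ n) * recip (n C ⌊ n /2⌋)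

theorem5p1 : (n : ℕ) → EZ n ≡ RHS n
theorem5p1 n = begin
  EZ n                                   ≡⟨ EZ≡ n ⟩
  ι * ∑< (suc n) (meanZeros n)           ≡⟨ cong (ι *_) (∑<-meanZeros n) ⟩
  ι * (ℕ→ℚ (suc n) + excess n)           ≡⟨ ℚₚ.*-distribˡ-+ ι (ℕ→ℚ (suc n)) (excess n) ⟩
  ι * ℕ→ℚ (suc n) + ι * excess n         ≡⟨ cong (_+ ι * excess n) ι*[n+1]≡1 ⟩
  1ℚ + ι * excess n                      ≡⟨ ℚₚ.+-comm 1ℚ (ι * excess n) ⟩
  ι * excess n + 1ℚ                      ≡⟨ RHS≡ n ⟨
  RHS n                                  ∎
  where
  ι = recip (suc n)
  ι*[n+1]≡1 : ι * ℕ→ℚ (suc n) ≡ 1ℚ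
  ι*[n+1]≡1 = trans (ℚₚ.*-comm ι (ℕ→ℚ (suc n))) (ℕ→ℚ-*-recip (suc n) (s≤s z≤n))
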